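{- Let $F$ be an unsatisfiable formula not containing the variables $x$ and $y$, and let $f_y^x(F)=\{x,\ \neg x\vee y\}\cup\{\neg y\vee\delta : \delta\in F\}$. Then every optimal (minimum-size) regular resolution proof of $f_y^x(F)$ contains exactly one resolution step on $x$, and this step can be pushed to the leaf level, i.e., there is an optimal regular resolution proof of $f_y^x(F)$ whose unique resolution step on $x$ resolves the leaf clauses $x$ and $\neg x\vee y$.
   Context: Resolution: from clauses $\gamma\vee x$ and $\delta\vee\neg x$ derive the resolvent $\gamma\vee\delta$ (resolving on $x$). A resolution proof of a formula $F$ is a directed acyclic graph whose nodes are clauses, whose leaves are clauses of $F$, in which each internal node is the resolvent of its two children, and whose root is the empty clause. It is regular if no path from the root to a leaf contains two resolution steps on the same variable. The size of a proof is its number of nodes; an optimal proof has minimum size. -}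

module Defs where

open import Data.Nat using (ℕ; _<_; _≤_)
open import Data.Bool using (Bool; true; false; not)
open import Data.Fin using (Fin; toℕ)
open import Data.List using (List; []; _∷_; map)
open import Data.List.Membership.Propositional using (_∈_; _∉_)
open import Data.List.Relation.Unary.All using (All)
open import Data.List.Relation.Unary.Any using (Any)
open import Data.List.Relation.Unary.Unique.Propositional using (Unique)
open import Data.Product using (Σ; ∃; ∃-syntax; _×_)
open import Data.Sum using (_⊎_)
open import Relation.Binary.PropositionalEquality using (_≡_; _≢_)
open import Relation.Nullary using (¬_)
open import Function.Bundles using (_⇔_)

Var : Set
Var = ℕ

data Literal : Set where
  pos : Var → Literal
  neg : Var → Literal

var : Literal → Var
var (pos v) = v
var (neg v) = v

-- A clause is a (finite) set of literals, represented by a list;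
-- clauses are compared as sets (same members).
Clause : Set
Clause = List Literal

Formula : Set
Formula = List Clause

_≈ᶜ_ : Clause → Clause → Set
C ≈ᶜ D = ∀ l → (l ∈ C) ⇔ (l ∈ D)

Assignment : Set
Assignment = Var → Bool

litVal : Assignment → Literal → Bool
litVal α (pos v) = α v
litVal α (neg v) = not (α v)

SatClause : Assignment → Clause → Set
SatClause α C = Any (λ l → litVal α l ≡ true) C

SatFormula : Assignment → Formula → Set
SatFormula α F = All (SatClause α) F

Unsatisfiable : Formula → Set
Unsatisfiable F = ∀ (α : Assignment) → ¬ SatFormula α F

NotIn : Var → Formula → Set
NotIn v F = ∀ {C} → C ∈ F → ∀ {l} → l ∈ C → var l ≢ v

fxy : Var → Var → Formula → Formula
fxy x y F = (pos x ∷ []) ∷ (neg x ∷ pos y ∷ []) ∷ map (neg y ∷_) F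

-- Resolution proofs as DAGs.
-- Nodes are Fin size; each node is labelled by a clause and is either a
-- leaf or a resolution step  res x j k : clause j = γ ∨ x, clause k = δ ∨ ¬x,
-- and the node's clause is γ ∨ δ.  Acyclicity: children have smaller index.

data Step (n : ℕ) : Set where
  leaf : Step n
  res  : Var → Fin n → Fin n → Step n

IsResolvent : Var → Clause → Clause → Clause → Set
IsResolvent x C₁ C₂ C =
  (pos x ∈ C₁) × (neg x ∈ C₂) ×
  (∀ l → (l ∈ C) ⇔ ((l ∈ C₁ × l ≢ pos x) ⊎ (l ∈ C₂ × l ≢ neg x)))

ValidStep : ∀ {n} → Formula → (Fin n → Clause) → Fin n → Step n → Set
ValidStep F cl i leaf = ∃[ D ] (D ∈ F × cl i ≈ᶜ D)
ValidStep F cl i (res x j k) =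
  (toℕ j < toℕ i) × (toℕ k < toℕ i) × IsResolvent x (cl j) (cl k) (cl i)

data Reach {n : ℕ} (step : Fin n → Step n) (root : Fin n) : Fin n → Set where
  here  : Reach step root root
  viaL  : ∀ {i x j k} → Reach step root i → step i ≡ res x j k → Reach step root j
  viaR  : ∀ {i x j k} → Reach step root i → step i ≡ res x j k → Reach step root k

record Proof (F : Formula) : Set where
  field
    size      : ℕ
    clause    : Fin size → Clause
    step      : Fin size → Step size
    root      : Fin size
    valid     : ∀ i → ValidStep F clause i (step i)
    rootEmpty : ∀ l → l ∉ clause root
    connected : ∀ i → Reach step root i

open Proof public

data LeafPath {F : Formula} (P : Proof F) : Fin (size P) → List Var → Set where
  stop  : ∀ {i} → step P i ≡ leaf → LeafPath P i []
  left  : ∀ {i x j k xs} → step P i ≡ res x j k → LeafPath P j xs → LeafPath P i (x ∷ xs)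
  right : ∀ {i x j k xs} → step P i ≡ res x j k → LeafPath P k xs → LeafPath P i (x ∷ xs)

Regular : {F : Formula} → Proof F → Set
Regular P = ∀ xs → LeafPath P (root P) xs → Unique xs

OptimalRegular : {F : Formula} → Proof F → Set
OptimalRegular {F} P = Regular P × (∀ (Q : Proof F) → Regular Q → size P ≤ size Q)

ResOn : {F : Formula} → (P : Proof F) → Var → Fin (size P) → Set
ResOn P x i = ∃[ j ] ∃[ k ] (step P i ≡ res x j k)

ExactlyOneResOn : {F : Formula} → Proof F → Var → Set
ExactlyOneResOn P x = ∃[ i ] (ResOn P x i × (∀ i′ → ResOn P x i′ → i′ ≡ i))

ResOnLeaves : {F : Formula} → Proof F → Var → Var → Set
ResOnLeaves P x y = ∃[ i ] ∃[ j ] ∃[ k ]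
  ( step P i ≡ res x j k
  × step P j ≡ leaf × clause P j ≈ᶜ (pos x ∷ [])
  × step P k ≡ leaf × clause P k ≈ᶜ (neg x ∷ pos y ∷ []))

-- In f_y^x(F) the literal x occurs only in the axiom x and ¬x only in ¬x ∨ y. Under the
-- assignment making only x true, every axiom is satisfied or contains ¬x, and resolution on
-- any variable other than x preserves this; so every refutation resolves on x.
-- A regular refutation P can be rebuilt around the single leaf-level step x, ¬x ∨ y ⊢ y:
-- delete ¬x from every clause, bypass each step on x through its right premise, and turn
-- each copy of ¬x ∨ y into a copy of that step. Paths only lose their x's (gaining at most
-- a final one), so regularity survives. The rebuilt DAG has two new nodes, but every old
-- step on x and the axiom x it uses become unreachable; with two steps on x the result
-- would be smaller than P, so an optimal P has exactly one, and the rebuilt proof is again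
-- optimal. Optimal regular refutations exist because regular resolution is complete and
-- whether a regular refutation of a given size exists is decidable by finite enumeration.

module Submission where

open import Defs
open import Level using (0ℓ)
open import Data.Empty using (⊥; ⊥-elim)
open import Data.Unit using (⊤; tt)
open import Data.Bool using (true; false; not; _≟_)
open import Data.Bool.Properties using (not-¬)
open import Data.Nat as ℕ using (ℕ; zero; suc; _+_; _≤_; _<_; z≤n; s≤s)
import Data.Nat.Properties as ℕₚ
open import Data.Nat.Induction using (<-rec)
open import Data.Fin as Fin using (Fin; zero; suc; toℕ; punchIn; punchOut)
import Data.Fin.Properties as Finₚ
import Data.Fin.Induction as Finᵢ
open import Data.Vec as Vec using (Vec; []; _∷_)
import Data.Vec.Properties as Vecₚ
open import Data.List as List using (List; []; _∷_; map; _++_; filter; length)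
import Data.List.Properties as Listₚ
open import Data.List.Membership.Propositional using (_∈_; _∉_; find; lose)
open import Data.List.Membership.Propositional.Properties
  using (∈-map⁺; ∈-map⁻; ∈-concatMap⁺; ∈-allFin; ∈-lookup; ∈-filter⁺; ∈-filter⁻; ∈-++⁺ˡ; ∈-++⁺ʳ; ∈-++⁻)
import Data.List.Membership.DecPropositional as DecMembership
open import Data.List.Relation.Unary.Any as Any using (Any; here; there)
open import Data.List.Relation.Unary.Any.Properties using (lookup-index)
open import Data.List.Relation.Unary.All as All using (All; []; _∷_)
import Data.List.Relation.Unary.All.Properties as Allₚ
open import Data.List.Relation.Unary.AllPairs as AllPairs using ([]; _∷_)
open import Data.List.Relation.Unary.Unique.Propositional using (Unique)
import Data.List.Relation.Unary.Unique.Propositional.Properties as Uniqueₚ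
open import Data.Product using (Σ; ∃-syntax; _×_; _,_; proj₁; proj₂; map₂; uncurry)
open import Data.Product.Function.NonDependent.Propositional using (_×-⇔_)
open import Data.Sum as Sum using (_⊎_; inj₁; inj₂; [_,_]′)
open import Data.Sum.Function.Propositional using (_⊎-⇔_)
open import Function using (id; _∘_; case_of_)
open import Function.Bundles using (_⇔_; mk⇔; Equivalence)
open import Function.Construct.Composition using (_⇔-∘_)
open import Function.Construct.Symmetry using (⇔-sym)
import Induction.WellFounded as WF
open import Relation.Binary.Definitions using (DecidableEquality)
open import Relation.Binary.PropositionalEquality
open import Relation.Nullary using (¬_; Dec; yes; no; does)
open import Relation.Nullary.Decidable using (map′; ¬?; _⊎-dec_; _×-dec_; dec-true; dec-false)

open Equivalence using (to; from)

pos-injective : ∀ {u v} → pos u ≡ pos v → u ≡ v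
pos-injective refl = refl

neg-injective : ∀ {u v} → neg u ≡ neg v → u ≡ v
neg-injective refl = refl

_≟ˡ_ : DecidableEquality Literal
pos u ≟ˡ pos v = map′ (cong pos) pos-injective (u ℕ.≟ v)
pos u ≟ˡ neg v = no λ ()
neg u ≟ˡ pos v = no λ ()
neg u ≟ˡ neg v = map′ (cong neg) neg-injective (u ℕ.≟ v)

open DecMembership _≟ˡ_ using () renaming (_∈?_ to _∈ˡ?_)

≈ᶜ-refl : ∀ {C} → C ≈ᶜ C
≈ᶜ-refl _ = mk⇔ id id

_∖_ : Clause → Literal → Clause
C ∖ l = filter (λ l′ → ¬? (l′ ≟ˡ l)) C

∈-∖⁻ : ∀ {C l l′} → l′ ∈ C ∖ l → l′ ∈ C × l′ ≢ l
∈-∖⁻ {l = l} = ∈-filter⁻ (λ l′ → ¬? (l′ ≟ˡ l))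

∈-∖⁺ : ∀ {C l l′} → l′ ∈ C → l′ ≢ l → l′ ∈ C ∖ l
∈-∖⁺ {l = l} = ∈-filter⁺ (λ l′ → ¬? (l′ ≟ˡ l))

resolvent : Var → Clause → Clause → Clause
resolvent z C D = C ∖ pos z ++ D ∖ neg z

∈-resolvent : ∀ z C D {l} → l ∈ resolvent z C D ⇔ ((l ∈ C × l ≢ pos z) ⊎ (l ∈ D × l ≢ neg z))
∈-resolvent z C D = mk⇔ split join
  where
  split : ∀ {l} → l ∈ resolvent z C D → (l ∈ C × l ≢ pos z) ⊎ (l ∈ D × l ≢ neg z)
  split m with ∈-++⁻ (C ∖ pos z) m
  ... | inj₁ m′ = inj₁ (∈-∖⁻ m′)
  ... | inj₂ m′ = inj₂ (∈-∖⁻ m′)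
  join : ∀ {l} → (l ∈ C × l ≢ pos z) ⊎ (l ∈ D × l ≢ neg z) → l ∈ resolvent z C D
  join (inj₁ (m , ne)) = ∈-++⁺ˡ (∈-∖⁺ m ne)
  join (inj₂ (m , ne)) = ∈-++⁺ʳ (C ∖ pos z) (∈-∖⁺ m ne)

resolvent-isResolvent : ∀ z {C D} → pos z ∈ C → neg z ∈ D → IsResolvent z C D (resolvent z C D)
resolvent-isResolvent z {C} {D} p n = p , n , λ l → ∈-resolvent z C D

IsResolvent-sound : ∀ α {z C D E} → IsResolvent z C D E → SatClause α C → SatClause α D → SatClause α E
IsResolvent-sound α {z} (_ , _ , r) satC satD with find satC | find satD
... | l , l∈C , αl | l′ , l′∈D , αl′ with l ≟ˡ pos z | l′ ≟ˡ neg z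
...   | no l≢z    | _          = lose (from (r l) (inj₁ (l∈C , l≢z))) αl
...   | yes _     | no l′≢¬z   = lose (from (r l′) (inj₂ (l′∈D , l′≢¬z))) αl′
...   | yes refl  | yes refl   = ⊥-elim (not-¬ (sym αl) (sym αl′))

mapStep : ∀ {m n} → (Fin m → Fin n) → Step m → Step n
mapStep ι leaf        = leaf
mapStep ι (res z j k) = res z (ι j) (ι k)

mapStep-leaf⁻ : ∀ {m n} (ι : Fin m → Fin n) s → mapStep ι s ≡ leaf → s ≡ leaf
mapStep-leaf⁻ ι leaf refl = refl

mapStep-res⁻ : ∀ {m n} (ι : Fin m → Fin n) s {z j k} → mapStep ι s ≡ res z j k →
               ∃[ j′ ] ∃[ k′ ] (s ≡ res z j′ k′ × ι j′ ≡ j × ι k′ ≡ k)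
mapStep-res⁻ ι (res z j k) refl = j , k , refl , refl , refl

mapStep-∘ : ∀ {l m n} (ι : Fin m → Fin n) (κ : Fin l → Fin m) s → mapStep ι (mapStep κ s) ≡ mapStep (ι ∘ κ) s
mapStep-∘ ι κ leaf        = refl
mapStep-∘ ι κ (res z j k) = refl

mapStep-id : ∀ {n} (s : Step n) → mapStep id s ≡ s
mapStep-id leaf        = refl
mapStep-id (res z j k) = refl

res-injective : ∀ {n z z′} {j k j′ k′ : Fin n} → res z j k ≡ res z′ j′ k′ → z ≡ z′ × j ≡ j′ × k ≡ k′
res-injective refl = refl , refl , refl

leaf≢res : ∀ {n z} {j k : Fin n} → leaf ≢ res z j k
leaf≢res ()

step≢leaf-node : ∀ {n} {st : Fin n → Step n} {a b z j k} → st a ≡ res z j k → st b ≡ leaf → a ≢ b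
step≢leaf-node a-res b-leaf refl = leaf≢res (trans (sym b-leaf) a-res)

Premise : ∀ {n} → Fin n → Step n → Set
Premise d leaf        = ⊥
Premise d (res z j k) = j ≡ d ⊎ k ≡ d

premise? : ∀ {n} (d : Fin n) s → Dec (Premise d s)
premise? d leaf        = no id
premise? d (res z j k) = (j Fin.≟ d) ⊎-dec (k Fin.≟ d)

Premise-map : ∀ {m n} (ι : Fin m → Fin n) {d} s → Premise d s → Premise (ι d) (mapStep ι s)
Premise-map ι (res z j k) (inj₁ refl) = inj₁ refl
Premise-map ι (res z j k) (inj₂ refl) = inj₂ refl

HasParent : ∀ {n} → (Fin n → Step n) → Fin n → Set
HasParent st d = ∃[ p ] Premise d (st p)

hasParent? : ∀ {n} (st : Fin n → Step n) d → Dec (HasParent st d)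
hasParent? st d = Finₚ.any? λ p → premise? d (st p)

Ordered : ∀ {n} → (Fin n → Step n) → Set
Ordered st = ∀ i {z j k} → st i ≡ res z j k → j Fin.< i × k Fin.< i

valid⇒ordered : ∀ {G n} {cl : Fin n → Clause} {st : Fin n → Step n} →
                (∀ i → ValidStep G cl i (st i)) → Ordered st
valid⇒ordered {G} {cl = cl} valid i e with subst (ValidStep G cl i) e (valid i)
... | j<i , k<i , _ = j<i , k<i

fin-<-rec : ∀ {n} (P : Fin n → Set) → (∀ i → (∀ {j} → j Fin.< i → P j) → P i) → ∀ i → P i
fin-<-rec = WF.All.wfRec Finᵢ.<-wellFounded 0ℓ

-- Parents have larger indices, so reachability propagates downwards from the root.
reachable : ∀ {n} {st : Fin n → Step n} {rt} → Ordered st →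
            (∀ i → i ≡ rt ⊎ HasParent st i) → ∀ i → Reach st rt i
reachable {st = st} {rt} ordered orphanless = WF.All.wfRec Finᵢ.>-wellFounded 0ℓ (Reach st rt) descend
  where
  descend : ∀ i → (∀ {p} → i Fin.< p → Reach st rt p) → Reach st rt i
  descend i reach-above with orphanless i
  ... | inj₁ refl = here
  ... | inj₂ (p , premise) = below (st p) refl premise
    where
    below : ∀ s → st p ≡ s → Premise i s → Reach st rt i
    below (res z j k) e (inj₁ refl) = viaL (reach-above (proj₁ (ordered p e))) e
    below (res z j k) e (inj₂ refl) = viaR (reach-above (proj₂ (ordered p e))) e

data Path {n} (st : Fin n → Step n) : Fin n → List Var → Set where
  stop  : ∀ {i} → st i ≡ leaf → Path st i []
  left  : ∀ {i x j k xs} → st i ≡ res x j k → Path st j xs → Path st i (x ∷ xs)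
  right : ∀ {i x j k xs} → st i ≡ res x j k → Path st k xs → Path st i (x ∷ xs)

module _ {m n} {st′ : Fin m → Step m} {st : Fin n → Step n} (ι : Fin m → Fin n)
         (commutes : ∀ i → st (ι i) ≡ mapStep ι (st′ i)) where

  Path-map : ∀ {i xs} → Path st′ i xs → Path st (ι i) xs
  Path-map (stop e)    = stop (trans (commutes _) (cong (mapStep ι) e))
  Path-map (left e p)  = left (trans (commutes _) (cong (mapStep ι) e)) (Path-map p)
  Path-map (right e p) = right (trans (commutes _) (cong (mapStep ι) e)) (Path-map p)

  Path-unmap : ∀ {i xs} → Path st (ι i) xs → Path st′ i xs
  Path-unmap {i} (stop e) = stop (mapStep-leaf⁻ ι (st′ i) (trans (sym (commutes i)) e))
  Path-unmap {i} (left e p) with mapStep-res⁻ ι (st′ i) (trans (sym (commutes i)) e)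
  ... | _ , _ , e′ , refl , refl = left e′ (Path-unmap p)
  Path-unmap {i} (right e p) with mapStep-res⁻ ι (st′ i) (trans (sym (commutes i)) e)
  ... | _ , _ , e′ , refl , refl = right e′ (Path-unmap p)

Path-cong : ∀ {n} {st st′ : Fin n → Step n} → (∀ i → st i ≡ st′ i) → ∀ {i xs} → Path st i xs → Path st′ i xs
Path-cong e (stop q)    = stop (trans (sym (e _)) q)
Path-cong e (left q p)  = left (trans (sym (e _)) q) (Path-cong e p)
Path-cong e (right q p) = right (trans (sym (e _)) q) (Path-cong e p)

Path-leaf⁻ : ∀ {n} {st : Fin n → Step n} {i xs} → st i ≡ leaf → Path st i xs → xs ≡ []
Path-leaf⁻ _ (stop _)    = refl
Path-leaf⁻ l (left e _)  = ⊥-elim (leaf≢res (trans (sym l) e))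
Path-leaf⁻ l (right e _) = ⊥-elim (leaf≢res (trans (sym l) e))

Path-res⁻ : ∀ {n} {st : Fin n → Step n} {i z j k xs} → st i ≡ res z j k → Path st i xs →
            ∃[ xs′ ] xs ≡ z ∷ xs′ × (Path st j xs′ ⊎ Path st k xs′)
Path-res⁻ r (stop e) = ⊥-elim (leaf≢res (trans (sym e) r))
Path-res⁻ r (left e q) with res-injective (trans (sym r) e)
... | refl , refl , refl = _ , refl , inj₁ q
Path-res⁻ r (right e q) with res-injective (trans (sym r) e)
... | refl , refl , refl = _ , refl , inj₂ q

LeafPath⇒Path : ∀ {F} (P : Proof F) {i xs} → LeafPath P i xs → Path (step P) i xs
LeafPath⇒Path P (stop q)    = stop q
LeafPath⇒Path P (left q p)  = left q (LeafPath⇒Path P p)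
LeafPath⇒Path P (right q p) = right q (LeafPath⇒Path P p)

Path⇒LeafPath : ∀ {F} (P : Proof F) {i xs} → Path (step P) i xs → LeafPath P i xs
Path⇒LeafPath P (stop q)    = stop q
Path⇒LeafPath P (left q p)  = left q (Path⇒LeafPath P p)
Path⇒LeafPath P (right q p) = right q (Path⇒LeafPath P p)

valid-map : ∀ {G m n} {cl : Fin m → Clause} {cl′ : Fin n → Clause} (ι : Fin m → Fin n) →
            (∀ a → cl′ (ι a) ≡ cl a) → (∀ {a b} → a Fin.< b → ι a Fin.< ι b) →
            ∀ i s → ValidStep G cl i s → ValidStep G cl′ (ι i) (mapStep ι s)
valid-map ι same mono i leaf (D , D∈ , e) rewrite same i = D , D∈ , e
valid-map ι same mono i (res z j k) (j<i , k<i , r) rewrite same i | same j | same k = mono j<i , mono k<i , r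

valid-unmap : ∀ {G m n} {cl : Fin n → Clause} (ι : Fin m → Fin n) →
              (∀ {a b} → ι a Fin.< ι b → a Fin.< b) →
              ∀ i s → ValidStep G cl (ι i) (mapStep ι s) → ValidStep G (cl ∘ ι) i s
valid-unmap ι reflects i leaf v                      = v
valid-unmap ι reflects i (res z j k) (j<i , k<i , r) = reflects j<i , reflects k<i , r

-- Pre-proofs and deletion of unreachable nodes

-- A regular refutation in which nodes need not be reachable from the root.
record PreProof (G : Formula) (n : ℕ) : Set where
  field
    clause    : Fin n → Clause
    step      : Fin n → Step n
    root      : Fin n
    valid     : ∀ i → ValidStep G clause i (step i)
    rootEmpty : ∀ l → l ∉ clause root
    regular   : ∀ xs → Path step root xs → Unique xs

open PreProof public

toPreProof : ∀ {G} (P : Proof G) → Regular P → PreProof G (size P)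
toPreProof P reg = record
  { clause = clause P ; step = step P ; root = root P ; valid = valid P ; rootEmpty = rootEmpty P
  ; regular = λ xs p → reg xs (Path⇒LeafPath P p) }

record Embedding {G n} (Q : Proof G) (p : PreProof G n) : Set where
  field
    embed        : Fin (size Q) → Fin n
    clause-embed : ∀ i → clause Q i ≡ clause p (embed i)
    step-embed   : ∀ i → step p (embed i) ≡ mapStep embed (step Q i)

open Embedding

Orphan : ∀ {G n} → PreProof G n → Fin n → Set
Orphan p d = (∀ i → ¬ Premise d (step p i)) × d ≢ root p

orphan? : ∀ {G n} (p : PreProof G n) d → Dec (Orphan p d)
orphan? p d = Finₚ.all? (λ i → ¬? (premise? d (step p i))) ×-dec ¬? (d Fin.≟ root p)

punchOutStep : ∀ {m} (d : Fin (suc m)) s → ¬ Premise d s → Step m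
punchOutStep d leaf        _  = leaf
punchOutStep d (res z j k) ¬p = res z (punchOut (¬p ∘ inj₁ ∘ sym)) (punchOut (¬p ∘ inj₂ ∘ sym))

mapStep-punchOutStep : ∀ {m} d s ¬p → mapStep (punchIn d) (punchOutStep {m} d s ¬p) ≡ s
mapStep-punchOutStep d leaf        _ = refl
mapStep-punchOutStep d (res z j k) _ = cong₂ (res z) (Finₚ.punchIn-punchOut _) (Finₚ.punchIn-punchOut _)

punchIn-cancel-< : ∀ {m} (d : Fin (suc m)) {a b : Fin m} → punchIn d a Fin.< punchIn d b → a Fin.< b
punchIn-cancel-< d {a} {b} lt = ℕₚ.≰⇒> λ b≤a → ℕₚ.<⇒≱ lt (Finₚ.punchIn-mono-≤ d b a b≤a)

module _ {G : Formula} {m : ℕ} (p : PreProof G (suc m)) {d : Fin (suc m)} (orphan : Orphan p d) where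

  private
    step′ : Fin m → Step m
    step′ i = punchOutStep d (step p (punchIn d i)) (proj₁ orphan (punchIn d i))

    step-punchIn : ∀ i → step p (punchIn d i) ≡ mapStep (punchIn d) (step′ i)
    step-punchIn i = sym (mapStep-punchOutStep d _ _)

  delete : PreProof G m
  delete = record
    { clause    = clause p ∘ punchIn d
    ; step      = step′
    ; root      = punchOut (proj₂ orphan)
    ; valid     = λ i → valid-unmap (punchIn d) (punchIn-cancel-< d) i (step′ i)
                          (subst (ValidStep G (clause p) (punchIn d i)) (step-punchIn i) (valid p (punchIn d i)))
    ; rootEmpty = λ l → subst (λ r → l ∉ clause p r) (sym root-punchIn) (rootEmpty p l)
    ; regular   = λ xs q → regular p xs (subst (λ r → Path (step p) r xs) root-punchIn (Path-map (punchIn d) step-punchIn q))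
    }
    where
    root-punchIn : punchIn d (punchOut (proj₂ orphan)) ≡ root p
    root-punchIn = Finₚ.punchIn-punchOut _

  Orphan-delete : ∀ {b} (d≢b : d ≢ b) → Orphan p b → Orphan delete (punchOut d≢b)
  Orphan-delete d≢b (no-parent , b≢root) = no-parent′ , b≢root ∘ Finₚ.punchOut-injective d≢b (proj₂ orphan)
    where
    no-parent′ : ∀ i → ¬ Premise (punchOut d≢b) (step′ i)
    no-parent′ i prem = no-parent (punchIn d i)
      (subst₂ Premise (Finₚ.punchIn-punchOut d≢b) (mapStep-punchOutStep d _ _) (Premise-map (punchIn d) _ prem))

  Embedding-delete : ∀ {Q} → Embedding Q delete → Embedding Q p
  Embedding-delete {Q} e = record
    { embed        = punchIn d ∘ embed e
    ; clause-embed = clause-embed e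
    ; step-embed   = λ i → trans (step-punchIn (embed e i))
                             (trans (cong (mapStep (punchIn d)) (step-embed e i)) (mapStep-∘ (punchIn d) (embed e) (step Q i)))
    }

punchOutAll : ∀ {m} (d : Fin (suc m)) bs → All (d ≢_) bs → List (Fin m)
punchOutAll d []       []         = []
punchOutAll d (b ∷ bs) (d≢b ∷ ds) = punchOut d≢b ∷ punchOutAll d bs ds

length-punchOutAll : ∀ {m} (d : Fin (suc m)) bs ds → length (punchOutAll d bs ds) ≡ length bs
length-punchOutAll d []       []       = refl
length-punchOutAll d (b ∷ bs) (_ ∷ ds) = cong suc (length-punchOutAll d bs ds)

All-punchOutAll : ∀ {m} (d : Fin (suc m)) {P : Fin (suc m) → Set} {P′ : Fin m → Set} →
                  (∀ {b} (d≢b : d ≢ b) → P b → P′ (punchOut d≢b)) →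
                  ∀ bs ds → All P bs → All P′ (punchOutAll d bs ds)
All-punchOutAll d f []       []         []         = []
All-punchOutAll d f (b ∷ bs) (d≢b ∷ ds) (pb ∷ pbs) = f d≢b pb ∷ All-punchOutAll d f bs ds pbs

Unique-punchOutAll : ∀ {m} (d : Fin (suc m)) bs ds → Unique bs → Unique (punchOutAll d bs ds)
Unique-punchOutAll d []       []         []         = []
Unique-punchOutAll d (b ∷ bs) (d≢b ∷ ds) (b∉ ∷ u) =
  All-punchOutAll d (λ d≢c b≢c e → b≢c (Finₚ.punchOut-injective d≢b d≢c e)) bs ds b∉ ∷ Unique-punchOutAll d bs ds u

Collected : ∀ {G n} → PreProof G n → ℕ → Set
Collected {G} {n} p k = Σ (Proof G) λ Q → Regular Q × k + size Q ≤ n × Embedding Q p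

embed-leaf : ∀ {G n} {Q : Proof G} {p : PreProof G n} (e : Embedding Q p) {a b} →
             embed e a ≡ b → step p b ≡ leaf → step Q a ≡ leaf × clause Q a ≈ᶜ clause p b
embed-leaf {Q = Q} e {a} refl b-leaf =
  mapStep-leaf⁻ (embed e) (step Q a) (trans (sym (step-embed e a)) b-leaf) , subst (_≈ᶜ _) (sym (clause-embed e a)) ≈ᶜ-refl

orphanless⇒proof : ∀ {G n} (p : PreProof G n) → (∀ d → ¬ Orphan p d) → Collected p 0
orphanless⇒proof {G} {n} p orphanless =
  Q , (λ xs q → regular p xs (LeafPath⇒Path Q q)) , ℕₚ.≤-refl ,
  record { embed = id ; clause-embed = λ _ → refl ; step-embed = λ i → sym (mapStep-id (step p i)) }
  where
  root-or-parent : ∀ i → i ≡ root p ⊎ HasParent (step p) i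
  root-or-parent i with i Fin.≟ root p | hasParent? (step p) i
  ... | yes i≡root | _          = inj₁ i≡root
  ... | no _       | yes parent = inj₂ parent
  ... | no i≢root  | no ¬parent = ⊥-elim (orphanless i ((λ q prem → ¬parent (q , prem)) , i≢root))
  Q : Proof G
  Q = record { size = n ; clause = clause p ; step = step p ; root = root p ; valid = valid p
             ; rootEmpty = rootEmpty p ; connected = reachable (valid⇒ordered (valid p)) root-or-parent }

-- Deleting orphans until none is left makes every node reachable from the root.
collect : ∀ {G} n (p : PreProof G n) ds → Unique ds → All (Orphan p) ds → Collected p (length ds)
collect zero p _ _ _ with root p
... | ()
collect (suc m) p (d ∷ ds) (d∉ds ∷ u) (o ∷ os)
  with collect m (delete p o) (punchOutAll d ds d∉ds) (Unique-punchOutAll d ds d∉ds u)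
                 (All-punchOutAll d (Orphan-delete p o) ds d∉ds os)
... | Q , reg , small , e = Q , reg , small′ , Embedding-delete p o e
  where
  small′ : suc (length ds) + size Q ≤ suc m
  small′ rewrite sym (length-punchOutAll d ds d∉ds) = s≤s small
collect (suc m) p [] [] [] with Finₚ.any? (orphan? p)
... | no none = orphanless⇒proof p λ d o → none (d , o)
... | yes (d , o) with collect m (delete p o) [] [] []
...   | Q , reg , small , e = Q , reg , ℕₚ.m≤n⇒m≤1+n small , Embedding-delete p o e

-- Completeness of regular resolution

module Join {G : Formula} {n₁ n₂ : ℕ} (cl₁ : Fin n₁ → Clause) (st₁ : Fin n₁ → Step n₁)
            (cl₂ : Fin n₂ → Clause) (st₂ : Fin n₂ → Step n₂) (z : Var) (r₁ : Fin n₁) (r₂ : Fin n₂) (C : Clause) where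

  N : ℕ
  N = n₁ + (n₂ + 1)

  inl : Fin n₁ → Fin N
  inl i = i Fin.↑ˡ (n₂ + 1)

  inr : Fin n₂ → Fin N
  inr j = n₁ Fin.↑ʳ (j Fin.↑ˡ 1)

  top : Fin N
  top = n₁ Fin.↑ʳ (n₂ Fin.↑ʳ zero)

  select : {A : Set} → (Fin n₁ → A) → (Fin n₂ → A) → A → Fin N → A
  select f g a w = [ f , [ g , (λ _ → a) ]′ ∘ Fin.splitAt n₂ ]′ (Fin.splitAt n₁ w)

  select-inl : ∀ {A : Set} (f : Fin n₁ → A) g a i → select f g a (inl i) ≡ f i
  select-inl f g a i rewrite Finₚ.splitAt-↑ˡ n₁ i (n₂ + 1) = refl

  select-inr : ∀ {A : Set} (f : Fin n₁ → A) g a j → select f g a (inr j) ≡ g j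
  select-inr f g a j rewrite Finₚ.splitAt-↑ʳ n₁ (n₂ + 1) (j Fin.↑ˡ 1) | Finₚ.splitAt-↑ˡ n₂ j 1 = refl

  select-top : ∀ {A : Set} (f : Fin n₁ → A) g a → select f g a top ≡ a
  select-top f g a rewrite Finₚ.splitAt-↑ʳ n₁ (n₂ + 1) (n₂ Fin.↑ʳ zero) | Finₚ.splitAt-↑ʳ n₂ 1 zero = refl

  data View : Fin N → Set where
    left-part  : ∀ i → View (inl i)
    right-part : ∀ j → View (inr j)
    top-node   : View top

  view : ∀ w → View w
  view w with Fin.splitAt n₁ w in e
  ... | inj₁ i rewrite sym (Finₚ.splitAt⁻¹-↑ˡ e) = left-part i
  ... | inj₂ r with Fin.splitAt n₂ r in e′
  ...   | inj₁ j    rewrite sym (Finₚ.splitAt⁻¹-↑ʳ e) | sym (Finₚ.splitAt⁻¹-↑ˡ e′) = right-part j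
  ...   | inj₂ zero rewrite sym (Finₚ.splitAt⁻¹-↑ʳ e) | sym (Finₚ.splitAt⁻¹-↑ʳ e′) = top-node

  cl : Fin N → Clause
  cl = select cl₁ cl₂ C

  st : Fin N → Step N
  st = select (mapStep inl ∘ st₁) (mapStep inr ∘ st₂) (res z (inl r₁) (inr r₂))

  st-inl : ∀ i → st (inl i) ≡ mapStep inl (st₁ i)
  st-inl = select-inl _ _ _

  st-inr : ∀ j → st (inr j) ≡ mapStep inr (st₂ j)
  st-inr = select-inr _ _ _

  st-top : st top ≡ res z (inl r₁) (inr r₂)
  st-top = select-top _ _ _

  inl-mono : ∀ {a b} → a Fin.< b → inl a Fin.< inl b
  inl-mono {a} {b} a<b rewrite Finₚ.toℕ-↑ˡ a (n₂ + 1) | Finₚ.toℕ-↑ˡ b (n₂ + 1) = a<b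

  inr-mono : ∀ {a b} → a Fin.< b → inr a Fin.< inr b
  inr-mono {a} {b} a<b rewrite Finₚ.toℕ-↑ʳ n₁ (a Fin.↑ˡ 1) | Finₚ.toℕ-↑ʳ n₁ (b Fin.↑ˡ 1)
                             | Finₚ.toℕ-↑ˡ a 1 | Finₚ.toℕ-↑ˡ b 1 = ℕₚ.+-monoʳ-< n₁ a<b

  inl<top : inl r₁ Fin.< top
  inl<top rewrite Finₚ.toℕ-↑ˡ r₁ (n₂ + 1) | Finₚ.toℕ-↑ʳ n₁ (n₂ Fin.↑ʳ (zero {0})) =
    ℕₚ.<-≤-trans (Finₚ.toℕ<n r₁) (ℕₚ.m≤m+n n₁ _)

  inr<top : inr r₂ Fin.< top
  inr<top rewrite Finₚ.toℕ-↑ʳ n₁ (r₂ Fin.↑ˡ 1) | Finₚ.toℕ-↑ʳ n₁ (n₂ Fin.↑ʳ (zero {0}))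
                | Finₚ.toℕ-↑ˡ r₂ 1 | Finₚ.toℕ-↑ʳ n₂ (zero {0}) =
    ℕₚ.+-monoʳ-< n₁ (subst (toℕ r₂ <_) (sym (ℕₚ.+-identityʳ n₂)) (Finₚ.toℕ<n r₂))

  valid-join : (∀ i → ValidStep G cl₁ i (st₁ i)) → (∀ j → ValidStep G cl₂ j (st₂ j)) →
               IsResolvent z (cl₁ r₁) (cl₂ r₂) C → ∀ w → ValidStep G cl w (st w)
  valid-join valid₁ valid₂ r w with view w
  ... | left-part i  rewrite st-inl i = valid-map inl (select-inl cl₁ cl₂ C) inl-mono i (st₁ i) (valid₁ i)
  ... | right-part j rewrite st-inr j = valid-map inr (select-inr cl₁ cl₂ C) inr-mono j (st₂ j) (valid₂ j)
  ... | top-node     rewrite st-top | select-top cl₁ cl₂ C | select-inl cl₁ cl₂ C r₁ | select-inr cl₁ cl₂ C r₂ =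
                       inl<top , inr<top , r

  Path-top⁻ : ∀ {xs} → Path st top xs → ∃[ ys ] xs ≡ z ∷ ys × (Path st₁ r₁ ys ⊎ Path st₂ r₂ ys)
  Path-top⁻ q with Path-res⁻ st-top q
  ... | ys , refl , inj₁ q₁ = ys , refl , inj₁ (Path-unmap inl st-inl q₁)
  ... | ys , refl , inj₂ q₂ = ys , refl , inj₂ (Path-unmap inr st-inr q₂)

vars : Clause → List Var
vars = map var

open DecMembership ℕ._≟_ using () renaming (_∈?_ to _∈ᵛ?_)

formula-vars : Formula → List Var
formula-vars = List.concatMap vars

module Completeness (G : Formula) where

  -- K is the set of literals falsified on the current branch of a decision tree for G.
  record RegularDerivation (K : Clause) : Set where
    field
      size         : ℕ
      clause       : Fin size → Clause
      step         : Fin size → Step size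
      root         : Fin size
      valid        : ∀ i → ValidStep G clause i (step i)
      root⊆        : ∀ {l} → l ∈ clause root → l ∈ K
      paths-fresh  : ∀ xs → Path step root xs → Unique xs × All (_∉ vars K) xs

  Consistent : Clause → Set
  Consistent K = ∀ u → pos u ∈ K → neg u ∈ K → ⊥

  FalsifiesG : Clause → Set
  FalsifiesG K = ∀ α → All (λ l → litVal α l ≡ false) K → ¬ SatFormula α G

  Covers : Clause → List Var → Set
  Covers K us = ∀ u → u ∈ formula-vars G → u ∈ vars K ⊎ u ∈ us

  -- Once K mentions every variable, the assignment falsifying K falsifies some clause of G, which lies inside K.
  derive-axiom : ∀ K → Consistent K → FalsifiesG K → Covers K [] → RegularDerivation K
  derive-axiom K consistent falsifies covers = record
    { size = 1 ; clause = λ _ → D ; step = λ _ → leaf ; root = zero ; valid = λ _ → D , D∈G , ≈ᶜ-refl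
    ; root⊆ = D⊆K ; paths-fresh = fresh }
    where
    α : Assignment
    α u = does (neg u ∈ˡ? K)
    α-falsifies : All (λ l → litVal α l ≡ false) K
    α-falsifies = All.tabulate false-on
      where
      false-on : ∀ {l} → l ∈ K → litVal α l ≡ false
      false-on {pos u} u∈  = dec-false (neg u ∈ˡ? K) (consistent u u∈)
      false-on {neg u} ¬u∈ = cong not (dec-true (neg u ∈ˡ? K) ¬u∈)
    violated : Any (λ D → ¬ SatClause α D) G
    violated = Allₚ.¬All⇒Any¬ (λ D → Any.any? (λ l → litVal α l ≟ true) D) G (falsifies α α-falsifies)
    D : Clause
    D = proj₁ (find violated)
    D∈G : D ∈ G
    D∈G = proj₁ (proj₂ (find violated))
    D-false : ¬ SatClause α D
    D-false = proj₂ (proj₂ (find violated))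
    D⊆K : ∀ {l} → l ∈ D → l ∈ K
    D⊆K {neg u} l∈ with neg u ∈ˡ? K
    ... | yes ¬u∈ = ¬u∈
    ... | no ¬u∉  = ⊥-elim (D-false (lose l∈ (cong not (dec-false (neg u ∈ˡ? K) ¬u∉))))
    D⊆K {pos u} l∈ with covers u (∈-concatMap⁺ vars (lose D∈G (∈-map⁺ var l∈)))
    ... | inj₁ u∈K with ∈-map⁻ var u∈K
    ...   | pos _ , u∈ , refl = u∈
    ...   | neg _ , ¬u∈ , refl = ⊥-elim (D-false (lose l∈ (dec-true (neg u ∈ˡ? K) ¬u∈)))
    fresh : ∀ xs → Path (λ _ → leaf) zero xs → Unique xs × All (_∉ vars K) xs
    fresh _ (stop _) = [] , []

  weaken : ∀ {l K} (d : RegularDerivation (l ∷ K)) →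
           l ∉ RegularDerivation.clause d (RegularDerivation.root d) → RegularDerivation K
  weaken {l} {K} d l∉ = record
    { size = D.size ; clause = D.clause ; step = D.step ; root = D.root ; valid = D.valid
    ; root⊆ = root⊆ ; paths-fresh = λ xs q → map₂ (All.map (_∘ there)) (D.paths-fresh xs q) }
    where
    module D = RegularDerivation d
    root⊆ : ∀ {l′} → l′ ∈ D.clause D.root → l′ ∈ K
    root⊆ l′∈ with D.root⊆ l′∈
    ... | here refl = ⊥-elim (l∉ l′∈)
    ... | there l′∈K = l′∈K

  -- A subderivation that does not use its branch literal already derives a subclause of K.
  resolve : ∀ u {K} → u ∉ vars K → RegularDerivation (pos u ∷ K) → RegularDerivation (neg u ∷ K) → RegularDerivation K
  resolve u {K} u∉K d₁ d₂ with pos u ∈ˡ? D₁.clause D₁.root | neg u ∈ˡ? D₂.clause D₂.root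
    where
    module D₁ = RegularDerivation d₁
    module D₂ = RegularDerivation d₂
  ... | no u∉₁ | _       = weaken d₁ u∉₁
  ... | yes _  | no ¬u∉₂ = weaken d₂ ¬u∉₂
  ... | yes u∈₁ | yes ¬u∈₂ = record
    { size = J.N ; clause = J.cl ; step = J.st ; root = J.top
    ; valid = J.valid-join D₁.valid D₂.valid (resolvent-isResolvent u u∈₁ ¬u∈₂)
    ; root⊆ = root⊆ ; paths-fresh = paths-fresh }
    where
    module D₁ = RegularDerivation d₁
    module D₂ = RegularDerivation d₂
    C : Clause
    C = resolvent u (D₁.clause D₁.root) (D₂.clause D₂.root)
    module J = Join {G} D₁.clause D₁.step D₂.clause D₂.step u D₁.root D₂.root C
    root⊆ : ∀ {l} → l ∈ J.cl J.top → l ∈ K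
    root⊆ {l} l∈ with to (∈-resolvent u _ _) (subst (l ∈_) (J.select-top D₁.clause D₂.clause C) l∈)
    ... | inj₁ (l∈₁ , l≢u) with D₁.root⊆ l∈₁
    ...   | here refl = ⊥-elim (l≢u refl)
    ...   | there l∈K = l∈K
    root⊆ {l} l∈ | inj₂ (l∈₂ , l≢¬u) with D₂.root⊆ l∈₂
    ...   | here refl = ⊥-elim (l≢¬u refl)
    ...   | there l∈K = l∈K
    extend : ∀ {l ys} → var l ≡ u → Unique ys × All (_∉ vars (l ∷ K)) ys →
             Unique (u ∷ ys) × All (_∉ vars K) (u ∷ ys)
    extend refl (unique , fresh) =
      All.map (λ w∉ u≡w → w∉ (here (sym u≡w))) fresh ∷ unique , u∉K ∷ All.map (_∘ there) fresh
    paths-fresh : ∀ xs → Path J.st J.top xs → Unique xs × All (_∉ vars K) xs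
    paths-fresh xs q with J.Path-top⁻ q
    ... | ys , refl , inj₁ q₁ = extend {pos u} refl (D₁.paths-fresh ys q₁)
    ... | ys , refl , inj₂ q₂ = extend {neg u} refl (D₂.paths-fresh ys q₂)

  derive : ∀ us K → Consistent K → FalsifiesG K → Covers K us → RegularDerivation K
  derive []       K consistent falsifies covers = derive-axiom K consistent falsifies covers
  derive (u ∷ us) K consistent falsifies covers with u ∈ᵛ? vars K
  ... | yes u∈K = derive us K consistent falsifies covers′
    where
    covers′ : Covers K us
    covers′ w w∈ with covers w w∈
    ... | inj₁ w∈K         = inj₁ w∈K
    ... | inj₂ (here refl) = inj₁ u∈K
    ... | inj₂ (there w∈)  = inj₂ w∈
  ... | no u∉K = resolve u u∉K
    (derive us (pos u ∷ K) consistent-pos (λ α → falsifies α ∘ All.tail) (covers-∷ (pos u) refl))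
    (derive us (neg u ∷ K) consistent-neg (λ α → falsifies α ∘ All.tail) (covers-∷ (neg u) refl))
    where
    consistent-pos : Consistent (pos u ∷ K)
    consistent-pos w _           (here ())
    consistent-pos w (here refl) (there ¬w∈) = u∉K (∈-map⁺ var ¬w∈)
    consistent-pos w (there w∈)  (there ¬w∈) = consistent w w∈ ¬w∈
    consistent-neg : Consistent (neg u ∷ K)
    consistent-neg w (here ())   _
    consistent-neg w (there w∈)  (here refl) = u∉K (∈-map⁺ var w∈)
    consistent-neg w (there w∈)  (there ¬w∈) = consistent w w∈ ¬w∈
    covers-∷ : ∀ l → var l ≡ u → Covers (l ∷ K) us
    covers-∷ l refl w w∈ with covers w w∈
    ... | inj₁ w∈K         = inj₁ (there w∈K)
    ... | inj₂ (here refl) = inj₁ (here refl)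
    ... | inj₂ (there w∈)  = inj₂ w∈

  regular-refutation : Unsatisfiable G → Σ (Proof G) Regular
  regular-refutation unsat with collect _ refutation [] [] []
    where
    derivation : RegularDerivation []
    derivation = derive (formula-vars G) [] (λ _ ()) (λ α _ → unsat α) (λ _ → inj₂)
    module D = RegularDerivation derivation
    refutation : PreProof G D.size
    refutation = record
      { clause = D.clause ; step = D.step ; root = D.root ; valid = D.valid
      ; rootEmpty = λ _ l∈ → case D.root⊆ l∈ of λ () ; regular = λ xs q → proj₁ (D.paths-fresh xs q) }
  ... | Q , reg , _ = Q , reg

-- Deciding whether a regular refutation of a given size exists

empty-clause : ∀ (C : Clause) → (∀ l → l ∉ C) → C ≡ []
empty-clause []      _ = refl
empty-clause (l ∷ C) h = ⊥-elim (h l (here refl))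

literal-vars : ∀ {G n} {cl : Fin n → Clause} {st : Fin n → Step n} → (∀ i → ValidStep G cl i (st i)) →
               ∀ i {l} → l ∈ cl i → var l ∈ formula-vars G
literal-vars {G} {n} {cl} {st} valid = fin-<-rec VarsInG go
  where
  VarsInG : Fin n → Set
  VarsInG i = ∀ {l} → l ∈ cl i → var l ∈ formula-vars G
  go : ∀ i → (∀ {j} → j Fin.< i → VarsInG j) → VarsInG i
  go i ih {l} l∈ with st i | valid i
  ... | leaf      | D , D∈G , c = ∈-concatMap⁺ vars (lose D∈G (∈-map⁺ var (to (c _) l∈)))
  ... | res z j k | j<i , k<i , _ , _ , r with to (r l) l∈
  ...   | inj₁ (l∈j , _) = ih j<i l∈j
  ...   | inj₂ (l∈k , _) = ih k<i l∈k

module Search (G : Formula) (m : ℕ) where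

  data Code : Set where
    axiom      : Fin (length G) → Code
    resolution : Var → Fin m → Fin m → Code

  code-step : Code → Step m
  code-step (axiom _)          = leaf
  code-step (resolution z j k) = res z j k

  codes : List Code
  codes = map axiom (List.allFin (length G)) ++
          List.concatMap (λ z → List.concatMap (λ j → map (resolution z j) (List.allFin m)) (List.allFin m)) (formula-vars G)

  axiom∈codes : ∀ d → axiom d ∈ codes
  axiom∈codes d = ∈-++⁺ˡ (∈-map⁺ axiom (∈-allFin d))

  resolution∈codes : ∀ {z} j k → z ∈ formula-vars G → resolution z j k ∈ codes
  resolution∈codes {z} j k z∈ = ∈-++⁺ʳ (map axiom (List.allFin (length G)))
    (∈-concatMap⁺ _ (lose z∈ (∈-concatMap⁺ _ (lose (∈-allFin j) (∈-map⁺ (resolution z j) (∈-allFin k))))))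

  vectors : (k : ℕ) → List (Vec Code k)
  vectors zero    = [] ∷ []
  vectors (suc k) = List.concatMap (λ c → map (c ∷_) (vectors k)) codes

  tabulate∈vectors : ∀ k (f : Fin k → Code) → (∀ i → f i ∈ codes) → Vec.tabulate f ∈ vectors k
  tabulate∈vectors zero    f f∈ = here refl
  tabulate∈vectors (suc k) f f∈ =
    ∈-concatMap⁺ _ (lose (f∈ zero) (∈-map⁺ (f zero ∷_) (tabulate∈vectors k (f ∘ suc) (f∈ ∘ suc))))

  -- The clause and path labels of a coded DAG are computed with fuel; fuel m suffices for every node.
  module Candidate (v : Vec Code m) where

    code : Fin m → Code
    code = Vec.lookup v

    step-of : Fin m → Step m
    step-of = code-step ∘ code

    clause-of : ℕ → Fin m → Clause
    code-clause : ℕ → Code → Clause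
    clause-of zero    i = []
    clause-of (suc f) i = code-clause f (code i)
    code-clause f (axiom d)          = List.lookup G d
    code-clause f (resolution z j k) = resolvent z (clause-of f j) (clause-of f k)

    paths-of : ℕ → Fin m → List (List Var)
    code-paths : ℕ → Code → List (List Var)
    paths-of zero    i = []
    paths-of (suc f) i = code-paths f (code i)
    code-paths f (axiom _)          = [] ∷ []
    code-paths f (resolution z j k) = map (z ∷_) (paths-of f j ++ paths-of f k)

    CodeOrdered : Fin m → Code → Set
    CodeOrdered i (axiom _)          = ⊤
    CodeOrdered i (resolution z j k) = j Fin.< i × k Fin.< i

    CodeValid : Fin m → Code → Set
    CodeValid i (axiom _)          = ⊤
    CodeValid i (resolution z j k) = (j Fin.< i × k Fin.< i) × pos z ∈ clause-of m j × neg z ∈ clause-of m k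

    codeValid? : ∀ i c → Dec (CodeValid i c)
    codeValid? i (axiom _)          = yes tt
    codeValid? i (resolution z j k) =
      ((toℕ j ℕ.<? toℕ i) ×-dec (toℕ k ℕ.<? toℕ i)) ×-dec (pos z ∈ˡ? clause-of m j) ×-dec (neg z ∈ˡ? clause-of m k)

    Refutation : Fin m → Set
    Refutation r = (∀ i → CodeValid i (code i)) × clause-of m r ≡ [] × All Unique (paths-of m r)

    refutation? : ∀ r → Dec (Refutation r)
    refutation? r = Finₚ.all? (λ i → codeValid? i (code i)) ×-dec Listₚ.≡-dec _≟ˡ_ (clause-of m r) []
                    ×-dec All.all? unique? (paths-of m r)
      where
      unique? : ∀ xs → Dec (Unique xs)
      unique? = AllPairs.allPairs? λ a b → ¬? (a ℕ.≟ b)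

    paths-sound : ∀ f i {xs} → xs ∈ paths-of f i → Path step-of i xs
    paths-sound (suc f) i xs∈ with code i in e
    ... | axiom _ with xs∈
    ...   | here refl = stop (cong code-step e)
    paths-sound (suc f) i xs∈ | resolution z j k with ∈-map⁻ (z ∷_) xs∈
    ...   | ys , ys∈ , refl with ∈-++⁻ (paths-of f j) ys∈
    ...     | inj₁ ys∈j = left  (cong code-step e) (paths-sound f j ys∈j)
    ...     | inj₂ ys∈k = right (cong code-step e) (paths-sound f k ys∈k)

    module Ordered (ordered : ∀ i → CodeOrdered i (code i)) where

      fuel-stable : ∀ f f′ i → toℕ i < f → toℕ i < f′ → clause-of f i ≡ clause-of f′ i
      fuel-stable (suc f) (suc f′) i (s≤s i<f) (s≤s i<f′) with code i | ordered i
      ... | axiom _          | _         = refl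
      ... | resolution z j k | j<i , k<i =
        cong₂ (resolvent z) (fuel-stable f f′ j (ℕₚ.<-≤-trans j<i i<f) (ℕₚ.<-≤-trans j<i i<f′))
                            (fuel-stable f f′ k (ℕₚ.<-≤-trans k<i i<f) (ℕₚ.<-≤-trans k<i i<f′))

      clause-axiom : ∀ f i {d} → toℕ i < f → code i ≡ axiom d → clause-of f i ≡ List.lookup G d
      clause-axiom (suc f) i _ e rewrite e = refl

      clause-resolution : ∀ f i {z j k} → toℕ i < f → code i ≡ resolution z j k →
                          clause-of f i ≡ resolvent z (clause-of f j) (clause-of f k)
      clause-resolution (suc f) i {z} {j} {k} (s≤s i<f) e with ordered i
      ... | o rewrite e with o
      ...   | j<i , k<i = cong₂ (resolvent z) (one-more j<i) (one-more k<i)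
        where
        one-more : ∀ {a} → a Fin.< i → clause-of f a ≡ clause-of (suc f) a
        one-more a<i = fuel-stable f (suc f) _ (ℕₚ.<-≤-trans a<i i<f) (ℕₚ.<-≤-trans a<i (ℕₚ.m≤n⇒m≤1+n i<f))

      paths-complete : ∀ f i {xs} → toℕ i < f → Path step-of i xs → xs ∈ paths-of f i
      paths-complete (suc f) i (s≤s i<f) q with code i in e | ordered i
      ... | axiom _ | _ rewrite Path-leaf⁻ (cong code-step e) q = here refl
      ... | resolution z j k | j<i , k<i with Path-res⁻ (cong code-step e) q
      ...   | ys , refl , inj₁ qj = ∈-map⁺ (z ∷_) (∈-++⁺ˡ (paths-complete f j (ℕₚ.<-≤-trans j<i i<f) qj))
      ...   | ys , refl , inj₂ qk = ∈-map⁺ (z ∷_) (∈-++⁺ʳ (paths-of f j) (paths-complete f k (ℕₚ.<-≤-trans k<i i<f) qk))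

    ordered-valid : ∀ i c → CodeValid i c → CodeOrdered i c
    ordered-valid i (axiom _)          _       = tt
    ordered-valid i (resolution z j k) (o , _) = o

    refutation⇒preproof : ∀ r → Refutation r → PreProof G m
    refutation⇒preproof r (codes-valid , root-empty , unique) = record
      { clause    = clause-of m
      ; step      = step-of
      ; root      = r
      ; valid     = λ i → valid-code i (code i) refl (codes-valid i)
      ; rootEmpty = λ l l∈ → case subst (l ∈_) root-empty l∈ of λ ()
      ; regular   = λ xs q → All.lookup unique (paths-complete m r (Finₚ.toℕ<n r) q)
      }
      where
      open Ordered (λ i → ordered-valid i (code i) (codes-valid i))
      valid-code : ∀ i c → code i ≡ c → CodeValid i c → ValidStep G (clause-of m) i (code-step c)
      valid-code i (axiom d) e _ =
        List.lookup G d , ∈-lookup d , subst (_≈ᶜ _) (sym (clause-axiom m i (Finₚ.toℕ<n i) e)) ≈ᶜ-refl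
      valid-code i (resolution z j k) e ((j<i , k<i) , z∈ , ¬z∈) =
        j<i , k<i , subst (IsResolvent z _ _) (sym (clause-resolution m i (Finₚ.toℕ<n i) e)) (resolvent-isResolvent z z∈ ¬z∈)

  module Encode (p : PreProof G m) where

    encode : ∀ i s → ValidStep G (clause p) i s → Code
    encode i leaf        (_ , D∈G , _) = axiom (Any.index D∈G)
    encode i (res z j k) _             = resolution z j k

    encoding : Vec Code m
    encoding = Vec.tabulate λ i → encode i (step p i) (valid p i)

    open Candidate encoding

    code≡encode : ∀ i → code i ≡ encode i (step p i) (valid p i)
    code≡encode i = Vecₚ.lookup∘tabulate _ i

    encoding∈vectors : encoding ∈ vectors m
    encoding∈vectors = tabulate∈vectors m _ λ i → encode∈codes i (step p i) (valid p i)
      where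
      encode∈codes : ∀ i s w → encode i s w ∈ codes
      encode∈codes i leaf        _                 = axiom∈codes _
      encode∈codes i (res z j k) (_ , _ , z∈j , _) = resolution∈codes j k (literal-vars (valid p) j z∈j)

    ordered : ∀ i → CodeOrdered i (code i)
    ordered i rewrite code≡encode i = by (step p i) (valid p i)
      where
      by : ∀ s w → CodeOrdered i (encode i s w)
      by leaf        _               = tt
      by (res z j k) (j<i , k<i , _) = j<i , k<i

    open Ordered ordered

    step-of≡ : ∀ i → step-of i ≡ step p i
    step-of≡ i = trans (cong code-step (code≡encode i)) (by (step p i) (valid p i))
      where
      by : ∀ s w → code-step (encode i s w) ≡ s
      by leaf        _ = refl
      by (res z j k) _ = refl

    clause-of≈ : ∀ i → clause-of m i ≈ᶜ clause p i
    clause-of≈ = fin-<-rec _ λ i ih → by i ih (step p i) (valid p i) (code≡encode i)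
      where
      by : ∀ i → (∀ {j} → j Fin.< i → clause-of m j ≈ᶜ clause p j) →
           ∀ s (w : ValidStep G (clause p) i s) → code i ≡ encode i s w → clause-of m i ≈ᶜ clause p i
      by i ih leaf (D , D∈G , c) e l rewrite clause-axiom m i (Finₚ.toℕ<n i) e | sym (lookup-index D∈G) = ⇔-sym (c l)
      by i ih (res z j k) (j<i , k<i , _ , _ , r) e l rewrite clause-resolution m i (Finₚ.toℕ<n i) e =
        ⇔-sym (r l) ⇔-∘ (((ih j<i l ×-⇔ mk⇔ id id) ⊎-⇔ (ih k<i l ×-⇔ mk⇔ id id)) ⇔-∘ ∈-resolvent z _ _)

    refutation : Refutation (root p)
    refutation = codes-valid , empty-clause _ (λ l → rootEmpty p l ∘ to (clause-of≈ (root p) l)) ,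
                 All.tabulate λ {xs} xs∈ → regular p xs (Path-cong step-of≡ (paths-sound m (root p) xs∈))
      where
      codes-valid : ∀ i → CodeValid i (code i)
      codes-valid i rewrite code≡encode i = by (step p i) (valid p i)
        where
        by : ∀ s w → CodeValid i (encode i s w)
        by leaf        _                         = tt
        by (res z j k) (j<i , k<i , z∈j , ¬z∈k , _) = (j<i , k<i) , from (clause-of≈ j _) z∈j , from (clause-of≈ k _) ¬z∈k

  preproof? : Dec (PreProof G m)
  preproof? with Any.any? (λ v → Finₚ.any? (Candidate.refutation? v)) (vectors m)
  ... | yes found with find found
  ...   | v , _ , r , refutes = yes (Candidate.refutation⇒preproof v r refutes)
  preproof? | no none = no λ p → none (lose (Encode.encoding∈vectors p) (root p , Encode.refutation p))

-- Existence of optimal regular refutations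

Least : (ℕ → Set) → Set
Least P = ∃[ m ] P m × (∀ k → P k → m ≤ k)

least : (P : ℕ → Set) → (∀ n → Dec (P n)) → ∀ n → P n → Least P
least P P? = <-rec (λ n → P n → Least P) go
  where
  go : ∀ n → (∀ {k} → k < n → P k → Least P) → P n → Least P
  go n below pn with ℕₚ.anyUpTo? P? n
  ... | yes (k , k<n , pk) = below k<n pk
  ... | no none            = n , pn , λ k pk → ℕₚ.≮⇒≥ λ k<n → none (k , k<n , pk)

-- It suffices to minimise over pre-proofs: every proof is one, and collecting a smallest one gives a proof no larger.
optimal-regular-refutation : ∀ {G} → Unsatisfiable G → Σ (Proof G) OptimalRegular
optimal-regular-refutation {G} unsat with Completeness.regular-refutation G unsat
... | P , reg with least (PreProof G) (Search.preproof? G) (size P) (toPreProof P reg)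
...   | m , p , minimal with collect m p [] [] []
...     | Q , regQ , small , _ = Q , regQ , λ R regR → ℕₚ.≤-trans small (minimal (size R) (toPreProof R regR))

-- Refutations of f_y^x(F)

data _≼[_]_ : List Var → Var → List Var → Set where
  []   : ∀ {x} → [] ≼[ x ] []
  [x]  : ∀ {x} → (x ∷ []) ≼[ x ] []
  keep : ∀ {x z xs ys} → z ≢ x → xs ≼[ x ] ys → (z ∷ xs) ≼[ x ] (z ∷ ys)
  drop : ∀ {x xs ys} → xs ≼[ x ] ys → xs ≼[ x ] (x ∷ ys)

∈-≼ : ∀ {x xs ys a} → xs ≼[ x ] ys → a ∈ xs → a ∈ ys ⊎ a ≡ x
∈-≼ [x]        (here refl) = inj₂ refl
∈-≼ (keep _ r) (here refl) = inj₁ (here refl)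
∈-≼ (keep _ r) (there a∈)  = Sum.map₁ there (∈-≼ r a∈)
∈-≼ (drop r)   a∈          = Sum.map₁ there (∈-≼ r a∈)

Unique-≼ : ∀ {x xs ys} → xs ≼[ x ] ys → Unique ys → Unique xs
Unique-≼ []          _            = []
Unique-≼ [x]         _            = [] ∷ []
Unique-≼ (keep z≢x r) (z∉ys ∷ u) = All.tabulate z∉xs ∷ Unique-≼ r u
  where
  z∉xs : ∀ {w} → w ∈ _ → _ ≢ w
  z∉xs w∈ z≡w = [ (λ w∈ys → All.lookup z∉ys w∈ys z≡w) , (λ w≡x → z≢x (trans z≡w w≡x)) ]′ (∈-≼ r w∈)
Unique-≼ (drop r)    (_ ∷ u)      = Unique-≼ r u

module Fxy (F : Formula) (x y : Var) (x≢y : x ≢ y) (x∉F : NotIn x F) where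

  G : Formula
  G = fxy x y F

  fxy-unsatisfiable : Unsatisfiable F → Unsatisfiable G
  fxy-unsatisfiable unsat α (here αx ∷ here α¬x ∷ _) = not-¬ (sym αx) (sym α¬x)
  fxy-unsatisfiable unsat α (_ ∷ there (here αy) ∷ sat-guarded) = unsat α (All.map drop-¬y (Allₚ.map⁻ sat-guarded))
    where
    drop-¬y : ∀ {δ} → SatClause α (neg y ∷ δ) → SatClause α δ
    drop-¬y (here α¬y)   = ⊥-elim (not-¬ (sym αy) (sym α¬y))
    drop-¬y (there satδ) = satδ

  module Derivation {n} {cl : Fin n → Clause} {st : Fin n → Step n} (valid : ∀ i → ValidStep G cl i (st i)) where

    data Node (i : Fin n) : Set where
      unit-x-leaf  : st i ≡ leaf → cl i ≈ᶜ (pos x ∷ []) → Node i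
      x⇒y-leaf     : st i ≡ leaf → cl i ≈ᶜ (neg x ∷ pos y ∷ []) → Node i
      guarded-leaf : ∀ {δ} → st i ≡ leaf → δ ∈ F → cl i ≈ᶜ (neg y ∷ δ) → Node i
      x-step       : ∀ {j k} → st i ≡ res x j k → Node i
      other-step   : ∀ {z j k} → st i ≡ res z j k → z ≢ x → Node i

    node : ∀ i → Node i
    node i = classify (st i) refl (valid i)
      where
      classify : ∀ s → st i ≡ s → ValidStep G cl i s → Node i
      classify leaf e (_ , here refl , c)              = unit-x-leaf e c
      classify leaf e (_ , there (here refl) , c)      = x⇒y-leaf e c
      classify leaf e (_ , there (there D∈) , c) with ∈-map⁻ (neg y ∷_) D∈
      ... | _ , δ∈F , refl                             = guarded-leaf e δ∈F c
      classify (res z j k) e _ with z ℕ.≟ x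
      ... | yes refl = x-step e
      ... | no z≢x   = other-step e z≢x

    valid-res : ∀ {i z j k} → st i ≡ res z j k → ValidStep G cl i (res z j k)
    valid-res {i} e = subst (ValidStep G cl i) e (valid i)

    UnitIfPosX : Fin n → Set
    UnitIfPosX i = pos x ∈ cl i → st i ≡ leaf × cl i ≈ᶜ (pos x ∷ [])

    -- A premise containing x is the axiom x itself, so x never survives a resolution step.
    pos-x⇒unit-x-leaf : ∀ i → UnitIfPosX i
    pos-x⇒unit-x-leaf = fin-<-rec UnitIfPosX go
      where
      x∉resolvent : ∀ {i z j k} → (∀ {j} → j Fin.< i → UnitIfPosX j) → st i ≡ res z j k → pos x ∉ cl i
      x∉resolvent ih e x∈ with valid-res e
      ... | j<i , k<i , z∈j , ¬z∈k , r with to (r _) x∈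
      ...   | inj₁ (x∈j , x≢z) with to (proj₂ (ih j<i x∈j) _) z∈j
      ...     | here eq = x≢z (sym eq)
      x∉resolvent ih e x∈ | j<i , k<i , z∈j , ¬z∈k , r | inj₂ (x∈k , _) with to (proj₂ (ih k<i x∈k) _) ¬z∈k
      ...     | here ()

      go : ∀ i → (∀ {j} → j Fin.< i → UnitIfPosX j) → UnitIfPosX i
      go i ih x∈ with node i
      ... | unit-x-leaf e c = e , c
      ... | x⇒y-leaf _ c with to (c _) x∈
      ...   | there (here eq) = ⊥-elim (x≢y (pos-injective eq))
      go i ih x∈ | guarded-leaf _ δ∈F c with to (c _) x∈
      ...   | there x∈δ = ⊥-elim (x∉F δ∈F x∈δ refl)
      go i ih x∈ | x-step e       = ⊥-elim (x∉resolvent ih e x∈)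
      go i ih x∈ | other-step e _ = ⊥-elim (x∉resolvent ih e x∈)

    premises-of-x-step : ∀ {i j k} → st i ≡ res x j k → (st j ≡ leaf × cl j ≈ᶜ (pos x ∷ [])) × neg x ∈ cl k
    premises-of-x-step e with valid-res e
    ... | _ , _ , x∈j , ¬x∈k , _ = pos-x⇒unit-x-leaf _ x∈j , ¬x∈k

    neg-x∉x-step : ∀ {i j k} → st i ≡ res x j k → neg x ∉ cl i
    neg-x∉x-step e ¬x∈ with valid-res e | premises-of-x-step e
    ... | _ , _ , _ , _ , r | (_ , unit) , _ with to (r _) ¬x∈
    ...   | inj₁ (¬x∈j , _) with to (unit _) ¬x∈j
    ...     | here ()
    neg-x∉x-step e ¬x∈ | _ | _ | inj₂ (_ , ¬x≢¬x) = ¬x≢¬x refl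

    pos-x∉premises : ∀ {i z j k} → st i ≡ res z j k → z ≢ x → pos x ∉ cl j × pos x ∉ cl k
    pos-x∉premises e z≢x with valid-res e
    ... | _ , _ , z∈j , ¬z∈k , _ = x∉j , x∉k
      where
      x∉j : pos x ∉ cl _
      x∉j x∈j with to (proj₂ (pos-x⇒unit-x-leaf _ x∈j) _) z∈j
      ... | here eq = z≢x (pos-injective eq)
      x∉k : pos x ∉ cl _
      x∉k x∈k with to (proj₂ (pos-x⇒unit-x-leaf _ x∈k) _) ¬z∈k
      ... | here ()

    only-x : Assignment
    only-x v = does (v ℕ.≟ x)

    SatisfiedOrNegX : Fin n → Set
    SatisfiedOrNegX i = SatClause only-x (cl i) ⊎ neg x ∈ cl i

    -- Resolution is sound for the assignment making only x true, as long as no step resolves on x.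
    satisfied-or-neg-x : (∀ {i j k} → st i ≢ res x j k) → ∀ i → SatisfiedOrNegX i
    satisfied-or-neg-x no-x-step = fin-<-rec _ go
      where
      go : ∀ i → (∀ {j} → j Fin.< i → SatisfiedOrNegX j) → SatisfiedOrNegX i
      go i ih with node i
      ... | unit-x-leaf _ c    = inj₁ (lose (from (c _) (here refl)) (dec-true (x ℕ.≟ x) refl))
      ... | x⇒y-leaf _ c       = inj₂ (from (c _) (here refl))
      ... | guarded-leaf _ _ c = inj₁ (lose (from (c _) (here refl)) (cong not (dec-false (y ℕ.≟ x) (x≢y ∘ sym))))
      ... | x-step e           = ⊥-elim (no-x-step e)
      ... | other-step {z} e z≢x with valid-res e
      ...   | j<i , k<i , r = combine (ih j<i) (ih k<i)
        where
        ¬x-kept : neg x ≢ neg z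
        ¬x-kept = z≢x ∘ sym ∘ neg-injective
        combine : SatisfiedOrNegX _ → SatisfiedOrNegX _ → SatisfiedOrNegX i
        combine (inj₂ ¬x∈j) _           = inj₂ (from (proj₂ (proj₂ r) _) (inj₁ (¬x∈j , λ ())))
        combine (inj₁ _)    (inj₂ ¬x∈k) = inj₂ (from (proj₂ (proj₂ r) _) (inj₂ (¬x∈k , ¬x-kept)))
        combine (inj₁ satj) (inj₁ satk) = inj₁ (IsResolvent-sound only-x r satj satk)

    resolves-on-x? : (s : Step n) → Dec (∃[ j ] ∃[ k ] s ≡ res x j k)
    resolves-on-x? leaf = no λ ()
    resolves-on-x? (res z j k) with z ℕ.≟ x
    ... | yes refl = yes (j , k , refl)
    ... | no z≢x   = no λ { (_ , _ , e) → z≢x (proj₁ (res-injective e)) }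

    refutation-resolves-on-x : ∀ rt → (∀ l → l ∉ cl rt) → ∃[ i ] ∃[ j ] ∃[ k ] st i ≡ res x j k
    refutation-resolves-on-x rt empty with Finₚ.any? (resolves-on-x? ∘ st)
    ... | yes found = found
    ... | no none with satisfied-or-neg-x (λ {i} {j} {k} e → none (i , j , k , e)) rt
    ...   | inj₂ ¬x∈  = ⊥-elim (empty _ ¬x∈)
    ...   | inj₁ sat = ⊥-elim (empty _ (proj₁ (proj₂ (find sat))))

  x⇒y-resolves-to-y : IsResolvent x (pos x ∷ []) (neg x ∷ pos y ∷ []) (pos y ∷ [])
  x⇒y-resolves-to-y = here refl , here refl , λ l → mk⇔ to-premises from-premises
    where
    FromPremises : Literal → Set
    FromPremises l = (l ∈ pos x ∷ [] × l ≢ pos x) ⊎ (l ∈ neg x ∷ pos y ∷ [] × l ≢ neg x)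
    to-premises : ∀ {l} → l ∈ pos y ∷ [] → FromPremises l
    to-premises (here refl) = inj₂ (there (here refl) , λ ())
    from-premises : ∀ {l} → FromPremises l → l ∈ pos y ∷ []
    from-premises (inj₁ (here refl , x≢x))       = ⊥-elim (x≢x refl)
    from-premises (inj₂ (here refl , ¬x≢¬x))     = ⊥-elim (¬x≢¬x refl)
    from-premises (inj₂ (there (here refl) , _)) = here refl

  -- Nodes 0 and 1 of the pushed proof are the axioms x and ¬x ∨ y, and node 2 + v mirrors node v.
  -- Every derived clause loses its ¬x, steps on x are bypassed through their right premise,
  -- and each copy of ¬x ∨ y (and each old step on x) becomes the step x, ¬x ∨ y ⊢ y on nodes 0 and 1.
  module PushX {n} (p : PreProof G n) where
    open Derivation (valid p)

    shift : Fin n → Fin (2 + n)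
    shift v = suc (suc v)

    skip : Fin n → Fin n
    skip v with node v
    ... | unit-x-leaf _ _    = v
    ... | x⇒y-leaf _ _       = v
    ... | guarded-leaf _ _ _ = v
    ... | x-step {k = k} _   = k
    ... | other-step _ _     = v

    pushed-clause : Fin (2 + n) → Clause
    pushed-clause zero          = pos x ∷ []
    pushed-clause (suc zero)    = neg x ∷ pos y ∷ []
    pushed-clause (suc (suc v)) with node v
    ... | unit-x-leaf _ _           = pos x ∷ []
    ... | x⇒y-leaf _ _              = pos y ∷ []
    ... | guarded-leaf {δ} _ _ _    = neg y ∷ δ
    ... | x-step _                  = pos y ∷ []
    ... | other-step _ _            = clause p v ∖ neg x

    pushed-step : Fin (2 + n) → Step (2 + n)
    pushed-step zero          = leaf
    pushed-step (suc zero)    = leaf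
    pushed-step (suc (suc v)) with node v
    ... | unit-x-leaf _ _                 = leaf
    ... | x⇒y-leaf _ _                    = res x zero (suc zero)
    ... | guarded-leaf _ _ _              = leaf
    ... | x-step _                        = res x zero (suc zero)
    ... | other-step {z} {j} {k} _ _      = res z (shift (skip j)) (shift (skip k))

    Clean : Fin n → Set
    Clean v = pos x ∉ clause p v × (∀ {j k} → step p v ≢ res x j k)

    skip-clean : ∀ v → pos x ∉ clause p v → Clean (skip v)
    skip-clean v x∉ with node v
    ... | unit-x-leaf _ c      = ⊥-elim (x∉ (from (c _) (here refl)))
    ... | x⇒y-leaf e _         = x∉ , leaf≢res ∘ trans (sym e)
    ... | guarded-leaf e _ _   = x∉ , leaf≢res ∘ trans (sym e)
    ... | other-step e z≢x     = x∉ , z≢x ∘ proj₁ ∘ res-injective ∘ trans (sym e)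
    ... | x-step e             = x∉k , λ e′ → neg-x∉x-step e′ ¬x∈k
      where
      ¬x∈k : neg x ∈ clause p _
      ¬x∈k = proj₂ (premises-of-x-step e)
      x∉k : pos x ∉ clause p _
      x∉k x∈k with to (proj₂ (pos-x⇒unit-x-leaf _ x∈k) _) ¬x∈k
      ... | here ()

    skip-≤ : ∀ v → skip v Fin.≤ v
    skip-≤ v with node v
    ... | unit-x-leaf _ _    = ℕₚ.≤-refl
    ... | x⇒y-leaf _ _       = ℕₚ.≤-refl
    ... | guarded-leaf _ _ _ = ℕₚ.≤-refl
    ... | x-step e           = ℕₚ.<⇒≤ (proj₁ (proj₂ (valid-res e)))
    ... | other-step _ _     = ℕₚ.≤-refl

    ∈-skip : ∀ v {l} → l ≢ neg x → l ∈ clause p (skip v) ⇔ l ∈ clause p v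
    ∈-skip v {l} l≢¬x with node v
    ... | unit-x-leaf _ _    = mk⇔ id id
    ... | x⇒y-leaf _ _       = mk⇔ id id
    ... | guarded-leaf _ _ _ = mk⇔ id id
    ... | other-step _ _     = mk⇔ id id
    ... | x-step e with valid-res e | premises-of-x-step e
    ...   | _ , _ , _ , _ , r | (_ , unit) , _ = mk⇔ (λ l∈k → from (r l) (inj₂ (l∈k , l≢¬x))) from-step
      where
      from-step : l ∈ clause p v → l ∈ clause p _
      from-step l∈ with to (r l) l∈
      ... | inj₂ (l∈k , _) = l∈k
      ... | inj₁ (l∈j , l≢x) with to (unit _) l∈j
      ...   | here refl = ⊥-elim (l≢x refl)

    ∈-pushed-clean : ∀ w → Clean w → ∀ {l} → l ∈ pushed-clause (shift w) ⇔ (l ∈ clause p w × l ≢ neg x)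
    ∈-pushed-clean w (x∉ , no-x) {l} with node w
    ... | unit-x-leaf _ c        = ⊥-elim (x∉ (from (c _) (here refl)))
    ... | x-step e               = ⊥-elim (no-x e)
    ... | other-step _ _         = mk⇔ ∈-∖⁻ (λ (l∈ , l≢) → ∈-∖⁺ l∈ l≢)
    ... | x⇒y-leaf _ c           = mk⇔ (λ { (here refl) → from (c _) (there (here refl)) , λ () }) y-only
      where
      y-only : l ∈ clause p w × l ≢ neg x → l ∈ pos y ∷ []
      y-only (l∈ , l≢¬x) with to (c _) l∈
      ... | here refl         = ⊥-elim (l≢¬x refl)
      ... | there (here refl) = here refl
    ... | guarded-leaf {δ} _ δ∈F c = mk⇔ into (λ (l∈ , _) → to (c _) l∈)
      where
      into : l ∈ neg y ∷ δ → l ∈ clause p w × l ≢ neg x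
      into (here refl) = from (c _) (here refl) , x≢y ∘ sym ∘ neg-injective
      into (there l∈δ) = from (c _) (there l∈δ) , λ l≡¬x → x∉F δ∈F l∈δ (cong var l≡¬x)

    ∈-pushed-skip : ∀ v → pos x ∉ clause p v →
                    ∀ {l} → l ∈ pushed-clause (shift (skip v)) ⇔ (l ∈ clause p v × l ≢ neg x)
    ∈-pushed-skip v x∉ {l} = mk⇔
      (λ l∈ → let (l∈′ , l≢) = to pushed⇔ l∈ in to (∈-skip v l≢) l∈′ , l≢)
      (λ (l∈ , l≢) → from pushed⇔ (from (∈-skip v l≢) l∈ , l≢))
      where
      pushed⇔ : l ∈ pushed-clause (shift (skip v)) ⇔ (l ∈ clause p (skip v) × l ≢ neg x)
      pushed⇔ = ∈-pushed-clean (skip v) (skip-clean v x∉)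

    pushed-valid : ∀ i → ValidStep G pushed-clause i (pushed-step i)
    pushed-valid zero          = _ , here refl , ≈ᶜ-refl
    pushed-valid (suc zero)    = _ , there (here refl) , ≈ᶜ-refl
    -- pushed-clause occurs unapplied in the goal, so abstracting node v needs the extra rewrite.
    pushed-valid (suc (suc v)) with node v in eq
    ... | unit-x-leaf _ _      rewrite eq = _ , here refl , ≈ᶜ-refl
    ... | x⇒y-leaf _ _         rewrite eq = s≤s z≤n , s≤s (s≤s z≤n) , x⇒y-resolves-to-y
    ... | x-step _             rewrite eq = s≤s z≤n , s≤s (s≤s z≤n) , x⇒y-resolves-to-y
    ... | guarded-leaf _ δ∈F _ rewrite eq = _ , there (there (∈-map⁺ (neg y ∷_) δ∈F)) , ≈ᶜ-refl
    ... | other-step {z} {j} {k} e z≢x rewrite eq with valid-res e | pos-x∉premises e z≢x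
    ...   | j<v , k<v , z∈j , ¬z∈k , r | x∉j , x∉k =
            s≤s (s≤s (ℕₚ.≤-trans (s≤s (skip-≤ j)) j<v)) ,
            s≤s (s≤s (ℕₚ.≤-trans (s≤s (skip-≤ k)) k<v)) ,
            from Pj (z∈j , λ ()) ,
            from Pk (¬z∈k , z≢x ∘ neg-injective) ,
            λ l → mk⇔ (into l) (out l)
      where
      Pj : ∀ {l} → l ∈ pushed-clause (shift (skip j)) ⇔ (l ∈ clause p j × l ≢ neg x)
      Pj = ∈-pushed-skip j x∉j
      Pk : ∀ {l} → l ∈ pushed-clause (shift (skip k)) ⇔ (l ∈ clause p k × l ≢ neg x)
      Pk = ∈-pushed-skip k x∉k
      FromPremises : Literal → Set
      FromPremises l = (l ∈ pushed-clause (shift (skip j)) × l ≢ pos z) ⊎ (l ∈ pushed-clause (shift (skip k)) × l ≢ neg z)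
      into : ∀ l → l ∈ clause p v ∖ neg x → FromPremises l
      into l l∈ with ∈-∖⁻ l∈
      ... | l∈v , l≢¬x with to (r l) l∈v
      ...   | inj₁ (l∈j , l≢z)  = inj₁ (from Pj (l∈j , l≢¬x) , l≢z)
      ...   | inj₂ (l∈k , l≢¬z) = inj₂ (from Pk (l∈k , l≢¬x) , l≢¬z)
      out : ∀ l → FromPremises l → l ∈ clause p v ∖ neg x
      out l (inj₁ (l∈ , l≢z))  = let (l∈j , l≢¬x) = to Pj l∈ in ∈-∖⁺ (from (r l) (inj₁ (l∈j , l≢z))) l≢¬x
      out l (inj₂ (l∈ , l≢¬z)) = let (l∈k , l≢¬x) = to Pk l∈ in ∈-∖⁺ (from (r l) (inj₂ (l∈k , l≢¬z))) l≢¬x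

    root-clean : Clean (skip (root p))
    root-clean = skip-clean (root p) (rootEmpty p (pos x))

    path-skip : ∀ v {ys} → Path (step p) (skip v) ys →
                ∃[ ys′ ] Path (step p) v ys′ × (∀ {xs} → xs ≼[ x ] ys → xs ≼[ x ] ys′)
    path-skip v q with node v
    ... | unit-x-leaf _ _    = _ , q , id
    ... | x⇒y-leaf _ _       = _ , q , id
    ... | guarded-leaf _ _ _ = _ , q , id
    ... | x-step e           = _ , right e q , drop
    ... | other-step _ _     = _ , q , id

    data PushedView (v : Fin n) : Step (2 + n) → Set where
      from-unit-x  : pos x ∈ clause p v → PushedView v leaf
      from-guarded : step p v ≡ leaf → PushedView v leaf
      from-x⇒y     : step p v ≡ leaf → PushedView v (res x zero (suc zero))
      from-x-step  : ∀ {j k} → step p v ≡ res x j k → PushedView v (res x zero (suc zero))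
      mirror       : ∀ {z j k} → step p v ≡ res z j k → z ≢ x →
                     PushedView v (res z (shift (skip j)) (shift (skip k)))

    pushed-view : ∀ v → PushedView v (pushed-step (shift v))
    pushed-view v with node v
    ... | unit-x-leaf _ c    = from-unit-x (from (c _) (here refl))
    ... | guarded-leaf e _ _ = from-guarded e
    ... | x⇒y-leaf e _       = from-x⇒y e
    ... | x-step e           = from-x-step e
    ... | other-step e z≢x   = mirror e z≢x

    PathsBack : Fin n → Set
    PathsBack w = Clean w → ∀ {xs} → Path pushed-step (shift w) xs → ∃[ ys ] Path (step p) w ys × xs ≼[ x ] ys

    path-pushed : ∀ w → PathsBack w
    path-pushed = fin-<-rec PathsBack λ w ih clean q → follow w ih clean (pushed-view w) refl q
      where
      to-axiom : ∀ {xs} → Path pushed-step zero xs ⊎ Path pushed-step (suc zero) xs → xs ≡ []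
      to-axiom = [ Path-leaf⁻ refl , Path-leaf⁻ refl ]′
      follow : ∀ w → (∀ {u} → u Fin.< w → PathsBack u) → Clean w → ∀ {s xs} → PushedView w s →
               pushed-step (shift w) ≡ s → Path pushed-step (shift w) xs → ∃[ ys ] Path (step p) w ys × xs ≼[ x ] ys
      follow w ih (x∉ , _) (from-unit-x x∈) _ _ = ⊥-elim (x∉ x∈)
      follow w ih (_ , no-x) (from-x-step e) _ _ = ⊥-elim (no-x e)
      follow w ih _ (from-guarded e) s≡ q with Path-leaf⁻ s≡ q
      ... | refl = [] , stop e , []
      follow w ih _ (from-x⇒y e) s≡ q with Path-res⁻ s≡ q
      ... | _ , refl , q′ with to-axiom q′
      ...   | refl = [] , stop e , [x]
      follow w ih _ (mirror {j = j} {k} e z≢x) s≡ q with Path-res⁻ s≡ q | valid-res e | pos-x∉premises e z≢x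
      ... | _ , refl , inj₁ q′ | j<w , _ | x∉j , _ with ih (ℕₚ.≤-<-trans (skip-≤ j) j<w) (skip-clean j x∉j) q′
      ...   | ys , r , xs≼ys with path-skip j r
      ...     | _ , r′ , widen = _ , left e r′ , keep z≢x (widen xs≼ys)
      follow w ih _ (mirror {j = j} {k} e z≢x) s≡ q | _ , refl , inj₂ q′ | _ , k<w , _ | _ , x∉k
        with ih (ℕₚ.≤-<-trans (skip-≤ k) k<w) (skip-clean k x∉k) q′
      ...   | ys , r , xs≼ys with path-skip k r
      ...     | _ , r′ , widen = _ , right e r′ , keep z≢x (widen xs≼ys)

    pushed : PreProof G (2 + n)
    pushed = record
      { clause    = pushed-clause
      ; step      = pushed-step
      ; root      = shift (skip (root p))
      ; valid     = pushed-valid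
      ; rootEmpty = λ l l∈ → rootEmpty p l (proj₁ (to (∈-pushed-skip (root p) (rootEmpty p (pos x))) l∈))
      ; regular   = regular′
      }
      where
      regular′ : ∀ xs → Path pushed-step (shift (skip (root p))) xs → Unique xs
      regular′ xs q with path-pushed _ root-clean q
      ... | ys , r , xs≼ys with path-skip (root p) r
      ...   | ys′ , r′ , widen = Unique-≼ (widen xs≼ys) (regular p ys′ r′)

    shift-injective : ∀ {a b} → shift a ≡ shift b → a ≡ b
    shift-injective = Finₚ.suc-injective ∘ Finₚ.suc-injective

    unclean⇒orphan : ∀ c → ¬ Clean c → Orphan pushed (shift c)
    unclean⇒orphan c unclean = no-parent , unclean ∘ (λ e → subst Clean e root-clean) ∘ shift-injective ∘ sym
      where
      not-premise : ∀ {v s} → PushedView v s → ¬ Premise (shift c) s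
      not-premise (from-x⇒y _)    (inj₁ ())
      not-premise (from-x⇒y _)    (inj₂ ())
      not-premise (from-x-step _) (inj₁ ())
      not-premise (from-x-step _) (inj₂ ())
      not-premise (mirror e z≢x)  (inj₁ e′) =
        unclean (subst Clean (shift-injective e′) (skip-clean _ (proj₁ (pos-x∉premises e z≢x))))
      not-premise (mirror e z≢x)  (inj₂ e′) =
        unclean (subst Clean (shift-injective e′) (skip-clean _ (proj₂ (pos-x∉premises e z≢x))))
      no-parent : ∀ i → ¬ Premise (shift c) (pushed-step i)
      no-parent (suc (suc v)) = not-premise (pushed-view v)

    pushed-x-step : ∀ i {j k} → pushed-step i ≡ res x j k → j ≡ zero × k ≡ suc zero
    pushed-x-step (suc (suc v)) = at (pushed-view v)
      where
      at : ∀ {s j k} → PushedView v s → s ≡ res x j k → j ≡ zero × k ≡ suc zero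
      at (from-x⇒y _)   refl = refl , refl
      at (from-x-step _) refl = refl , refl
      at (mirror _ z≢x) e    = ⊥-elim (z≢x (proj₁ (res-injective e)))

    x-step-unclean : ∀ {a j k} → step p a ≡ res x j k → ¬ Clean a
    x-step-unclean a-x (_ , no-x) = no-x a-x

    x-premise-unclean : ∀ {a j k} → step p a ≡ res x j k → ¬ Clean j
    x-premise-unclean a-x (x∉j , _) = x∉j (proj₁ (proj₂ (proj₂ (valid-res a-x))))

    embedded-x-step-on-axioms : ∀ {Q} → Embedding Q pushed → ∀ {i j k} → step Q i ≡ res x j k →
                                (step Q j ≡ leaf × clause Q j ≈ᶜ (pos x ∷ [])) ×
                                (step Q k ≡ leaf × clause Q k ≈ᶜ (neg x ∷ pos y ∷ []))
    embedded-x-step-on-axioms e {i} i-x with pushed-x-step (embed e i) (trans (step-embed e i) (cong (mapStep (embed e)) i-x))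
    ... | j↦0 , k↦1 = embed-leaf e j↦0 refl , embed-leaf e k↦1 refl

    collect-unclean : ∀ cs → Unique cs → All (¬_ ∘ Clean) cs →
                      Σ (Proof G) λ Q → Regular Q × length cs + size Q ≤ 2 + n × Embedding Q pushed
    collect-unclean cs u unclean with collect (2 + n) pushed (map shift cs) (Uniqueₚ.map⁺ shift-injective u)
                                                   (Allₚ.map⁺ (All.map (unclean⇒orphan _) unclean))
    ... | Q , reg , small , e = Q , reg , subst (λ m → m + size Q ≤ 2 + n) (Listₚ.length-map shift cs) small , e

  -- Pushing a proof with two steps on x orphans both of them and the axiom x used by one of them.
  optimal⇒exactly-one-x-step : (P : Proof G) → OptimalRegular P → ExactlyOneResOn P x
  optimal⇒exactly-one-x-step P (reg , optimal) with Derivation.refutation-resolves-on-x (valid P) (root P) (rootEmpty P)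
  ... | a , j , k , a-x = a , (j , k , a-x) , unique
    where
    open Derivation (valid P)
    open PushX (toPreProof P reg)
    j-leaf : step P j ≡ leaf
    j-leaf = proj₁ (proj₁ (premises-of-x-step a-x))
    unique : ∀ b → ResOn P x b → b ≡ a
    unique b (_ , _ , b-x) with b Fin.≟ a
    ... | yes b≡a = b≡a
    ... | no b≢a with collect-unclean (a ∷ b ∷ j ∷ []) distinct
                        (x-step-unclean a-x ∷ x-step-unclean b-x ∷ x-premise-unclean a-x ∷ [])
      where
      distinct : Unique (a ∷ b ∷ j ∷ [])
      distinct = ((b≢a ∘ sym) ∷ step≢leaf-node a-x j-leaf ∷ []) ∷ (step≢leaf-node b-x j-leaf ∷ []) ∷ [] ∷ []
    ...   | Q , regQ , smaller , _ = ⊥-elim (ℕₚ.<⇒≱ (ℕₚ.+-cancelˡ-≤ 2 _ _ smaller) (optimal Q regQ))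

  optimal⇒optimal-with-x-step-on-axioms : (P : Proof G) → OptimalRegular P →
                                          Σ (Proof G) λ Q → OptimalRegular Q × ExactlyOneResOn Q x × ResOnLeaves Q x y
  optimal⇒optimal-with-x-step-on-axioms P (reg , optimal) with Derivation.refutation-resolves-on-x (valid P) (root P) (rootEmpty P)
  ... | a , j , k , a-x =
    optimal-pushed (collect-unclean (a ∷ j ∷ []) distinct (x-step-unclean a-x ∷ x-premise-unclean a-x ∷ []))
    where
    open Derivation (valid P)
    open PushX (toPreProof P reg)
    distinct : Unique (a ∷ j ∷ [])
    distinct = (step≢leaf-node a-x (proj₁ (proj₁ (premises-of-x-step a-x))) ∷ []) ∷ [] ∷ []
    optimal-pushed : Σ (Proof G) (λ Q → Regular Q × 2 + size Q ≤ 2 + size P × Embedding Q pushed) →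
                     Σ (Proof G) λ Q → OptimalRegular Q × ExactlyOneResOn Q x × ResOnLeaves Q x y
    optimal-pushed (Q , regQ , small , e) = Q , optimalQ , one , leaves
      where
      optimalQ : OptimalRegular Q
      optimalQ = regQ , λ R regR → ℕₚ.≤-trans (ℕₚ.+-cancelˡ-≤ 2 _ _ small) (optimal R regR)
      one : ExactlyOneResOn Q x
      one = optimal⇒exactly-one-x-step Q optimalQ
      leaves : ResOnLeaves Q x y
      leaves with one
      ... | i , (jQ , kQ , i-x) , _ with embedded-x-step-on-axioms e i-x
      ...   | (j-leaf , j-unit) , (k-leaf , k-x⇒y) = i , jQ , kQ , i-x , j-leaf , j-unit , k-leaf , k-x⇒y

lemma8 : (F : Formula) (x y : Var) → x ≢ y → Unsatisfiable F → NotIn x F → NotIn y F →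
         ((P : Proof (fxy x y F)) → OptimalRegular P → ExactlyOneResOn P x)
         × (Σ (Proof (fxy x y F)) λ P → (OptimalRegular P × ExactlyOneResOn P x × ResOnLeaves P x y))
lemma8 F x y x≢y unsat x∉F _ =
  optimal⇒exactly-one-x-step , uncurry optimal⇒optimal-with-x-step-on-axioms (optimal-regular-refutation (fxy-unsatisfiable unsat))
  where open Fxy F x y x≢y x∉F
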